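{- Every extreme point of $\Omega_n^{t\&h}$ is of the form \[\frac14\left(P+P^t+P^h+P^{\pi}\right)=\frac12\left(R+R^t\right)\] for some $n\times n$ permutation matrix $P$, where $R=\frac12(P+P^{\pi})$ is centrosymmetric.
   Context: For an $n\times n$ matrix $A=[a_{ij}]$: $A^t$ is the transpose; the Hankel transpose $A^h$ has $(i,j)$ entry $a_{n+1-j,n+1-i}$; $A^{\pi}$ has $(i,j)$ entry $a_{n+1-i,n+1-j}$. $A$ is Hankel-symmetric if $A^h=A$ and centrosymmetric if $A^{\pi}=A$. $\Omega_n^{t\&h}$ is the convex polytope of all $n\times n$ doubly stochastic matrices (nonnegative, all row and column sums $1$) that are both symmetric and Hankel-symmetric.
   Formalization: The matrices of $\Omega_n^{t\&h}$ have rational entries, and extremality is tested only against convex combinations, with rational weight, of two such rational matrices. -}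

module Defs where

open import Data.Nat using (ℕ; zero; suc)
open import Data.Fin using (Fin; zero; suc; opposite; _≟_)
open import Data.Fin.Permutation using (Permutation′; _⟨$⟩ʳ_)
open import Data.Rational using (ℚ; 0ℚ; 1ℚ; _+_; _*_; _-_; _≤_; _<_; _/_)
open import Data.Product using (_×_; Σ; ∃)
open import Relation.Binary.PropositionalEquality using (_≡_)
open import Relation.Nullary.Decidable using (⌊_⌋)
open import Data.Bool using (if_then_else_)

-- n × n matrices over ℚ (0-indexed; index i ↦ opposite i is i ↦ n-1-i)
Mat : ℕ → Set
Mat n = Fin n → Fin n → ℚ

_≐_ : ∀ {n} → Mat n → Mat n → Set
A ≐ B = ∀ i j → A i j ≡ B i j

sumFin : ∀ {n} → (Fin n → ℚ) → ℚ
sumFin {zero}  f = 0ℚ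
sumFin {suc n} f = f zero + sumFin (λ i → f (suc i))

_ᵗ : ∀ {n} → Mat n → Mat n
(A ᵗ) i j = A j i

_ʰ : ∀ {n} → Mat n → Mat n
(A ʰ) i j = A (opposite j) (opposite i)

_ᵖ : ∀ {n} → Mat n → Mat n
(A ᵖ) i j = A (opposite i) (opposite j)

_⊕_ : ∀ {n} → Mat n → Mat n → Mat n
(A ⊕ B) i j = A i j + B i j

_•_ : ∀ {n} → ℚ → Mat n → Mat n
(c • A) i j = c * A i j

DoublyStochastic : ∀ {n} → Mat n → Set
DoublyStochastic A =
  (∀ i j → 0ℚ ≤ A i j) ×
  (∀ i → sumFin (λ j → A i j) ≡ 1ℚ) ×
  (∀ j → sumFin (λ i → A i j) ≡ 1ℚ)

Symmetric : ∀ {n} → Mat n → Set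
Symmetric A = (A ᵗ) ≐ A

HankelSymmetric : ∀ {n} → Mat n → Set
HankelSymmetric A = (A ʰ) ≐ A

Centrosymmetric : ∀ {n} → Mat n → Set
Centrosymmetric A = (A ᵖ) ≐ A

InΩth : ∀ {n} → Mat n → Set
InΩth A = DoublyStochastic A × Symmetric A × HankelSymmetric A

ExtremeΩth : ∀ {n} → Mat n → Set
ExtremeΩth {n} A = InΩth A ×
  (∀ (B C : Mat n) (t : ℚ) → InΩth B → InΩth C → 0ℚ < t → t < 1ℚ →
     A ≐ ((t • B) ⊕ ((1ℚ - t) • C)) → B ≐ C)

permMat : ∀ {n} → Permutation′ n → Mat n
permMat σ i j = if ⌊ (σ ⟨$⟩ʳ i) ≟ j ⌋ then 1ℚ else 0ℚ

{-# OPTIONS --safe #-}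
-- An extreme point A of Ω^{t&h} is doubly stochastic, so by Hall's theorem (in Rado's form:
-- of two edges at one vertex, one can be deleted without destroying Hall's condition) the
-- support of A contains a permutation σ. Let P be its permutation matrix and
-- Q = ¼(P + Pᵗ + Pʰ + Pᵖ), which lies in Ω^{t&h}. For 0 < ε ≤ ½ below every A i (σ i) we have
-- εP ≤ A entrywise, and since averaging over ᵗ, ʰ, ᵖ fixes A, also εQ ≤ A. Then
-- A = εQ + (1 - ε)C with C = (A - εQ)/(1 - ε) ∈ Ω^{t&h}, and extremality forces A = Q.
module Submission where

open import Defs
open import Data.Nat using (ℕ)
open import Data.Fin.Permutation using (Permutation′)
open import Data.Rational using (½; _*_)
open import Data.Product using (_×_; Σ)

open import Algebra.Bundles using (Ring)
open import Data.Bool using (if_then_else_)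
open import Data.Fin using (Fin; zero; suc; opposite; _≟_; punchIn; punchOut)
import Data.Fin.Properties as Finₚ
open import Data.Fin.Permutation
  using (_⟨$⟩ʳ_; _⟨$⟩ˡ_; inverseˡ; inverseʳ; reverse; permutation)
open import Data.Fin.Subset
  using (Subset; inside; outside; ⊥; ⁅_⁆; _∈_; _∉_; _⊆_; _∪_; _∩_; _-_; ∣_∣; Nonempty)
open import Data.Fin.Subset.Properties
  using (_∈?_; drop-there; ∉⊥; x∈p∪q⁺; x∈p∪q⁻; x∈p∩q⁺; x∈p∩q⁻; p─⊥≡p; p─q⊆p; p⊆p∪q;
         x∈p∧x≢y⇒x∈p-y; x∈p⇒∣p-x∣<∣p∣; p⊆q⇒∣p∣≤∣q∣; p⊂q⇒∣p∣<∣q∣; x∈⁅x⁆; x∈⁅y⁆⇒x≡y;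
         x≢y⇒x∉⁅y⁆; ∣⁅x⁆∣≡1; nonempty?; Empty-unique; ∣⊥∣≡0; anySubset?)
import Data.List as List
open import Data.List.Relation.Unary.All.Properties using (tabulate⁺; tabulate⁻)
open import Data.Nat as ℕ using (zero; suc; z≤n; s≤s)
open import Data.Nat.Induction using (<-wellFounded)
import Data.Nat.Properties as ℕₚ
open import Data.Product using (_,_; proj₁; proj₂; ∃; ∃₂; ∃-syntax)
open import Data.Rational as ℚ using (ℚ; 0ℚ; 1ℚ; _+_; -_; _≤_; _<_; 1/_)
import Data.Rational.Properties as ℚₚ
open import Data.Rational.Solver using (module +-*-Solver)
open import Data.Sum using (_⊎_; inj₁; inj₂; swap)
open import Data.Vec using ([]; _∷_; here; there; tabulate)
open import Data.Vec.Properties using (lookup∘tabulate; lookup⇒[]=; []=⇒lookup)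
open import Data.Vec.Functional using (updateAt; removeAt)
open import Data.Vec.Functional.Properties using (updateAt-updates; updateAt-minimal)
open import Function using (_∘_; id)
open import Function.Definitions using (Injective)
open import Induction.WellFounded using (Acc; acc)
open import Relation.Binary.Bundles using (DecTotalOrder)
open import Relation.Binary.PropositionalEquality
open import Relation.Nullary using (Dec; yes; no; does; contradiction)
open import Relation.Nullary.Decidable using (dec-true; toWitness; decidable-stable; ¬?; _×-dec_)

open import Algebra.Definitions.RawMonoid ℚ.+-0-rawMonoid using () renaming (_×_ to _×ℚ_)
import Algebra.Properties.Semiring.Sum (Ring.semiring ℚₚ.+-*-ring) as ∑
import Algebra.Properties.CommutativeMonoid.Sum ℕₚ.+-0-commutativeMonoid as ∑ℕ
open import Data.List.Extrema (DecTotalOrder.totalOrder ℚₚ.≤-decTotalOrder)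
  using (min; argmin-all; min≤⊤; min≤xs)
open ℚₚ using (_<?_)
open +-*-Solver using (solve; _:+_; _:*_; :-_; _:=_; con)

sumFin≗∑ : ∀ {n} (f : Fin n → ℚ) → sumFin f ≡ ∑.sum f
sumFin≗∑ {zero}  f = refl
sumFin≗∑ {suc n} f = cong (f zero +_) (sumFin≗∑ (f ∘ suc))

sumFin-cong : ∀ {n} {f g : Fin n → ℚ} → (∀ i → f i ≡ g i) → sumFin f ≡ sumFin g
sumFin-cong {f = f} {g} f≗g rewrite sumFin≗∑ f | sumFin≗∑ g = ∑.sum-cong-≗ f≗g

sumFin-+ : ∀ {n} (f g : Fin n → ℚ) → sumFin (λ i → f i + g i) ≡ sumFin f + sumFin g
sumFin-+ f g rewrite sumFin≗∑ f | sumFin≗∑ g | sumFin≗∑ (λ i → f i + g i) = ∑.∑-distrib-+ f g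

sumFin-* : ∀ {n} (c : ℚ) (f : Fin n → ℚ) → sumFin (λ i → c * f i) ≡ c * sumFin f
sumFin-* c f rewrite sumFin≗∑ f | sumFin≗∑ (λ i → c * f i) = sym (∑.*-distribˡ-sum c f)

sumFin-comm : ∀ {m n} (f : Fin m → Fin n → ℚ) →
              sumFin (λ i → sumFin (f i)) ≡ sumFin (λ j → sumFin (λ i → f i j))
sumFin-comm f = begin
  sumFin (λ i → sumFin (f i))                 ≡⟨ sumFin-cong (λ i → sumFin≗∑ (f i)) ⟩
  sumFin (λ i → ∑.sum (f i))                  ≡⟨ sumFin≗∑ (λ i → ∑.sum (f i)) ⟩
  ∑.sum (λ i → ∑.sum (f i))                   ≡⟨ ∑.∑-comm f ⟩
  ∑.sum (λ j → ∑.sum (λ i → f i j))           ≡⟨ sumFin≗∑ (λ j → ∑.sum (λ i → f i j)) ⟨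
  sumFin (λ j → ∑.sum (λ i → f i j))          ≡⟨ sumFin-cong (λ j → sumFin≗∑ (λ i → f i j)) ⟨
  sumFin (λ j → sumFin (λ i → f i j))         ∎
  where open ≡-Reasoning

sumFin-opposite : ∀ {n} (f : Fin n → ℚ) → sumFin (f ∘ opposite) ≡ sumFin f
sumFin-opposite f rewrite sumFin≗∑ f | sumFin≗∑ (f ∘ opposite) = sym (∑.∑-permute f reverse)

sumFin-mono-≤ : ∀ {n} {f g : Fin n → ℚ} → (∀ i → f i ≤ g i) → sumFin f ≤ sumFin g
sumFin-mono-≤ {zero}  f≤g = ℚₚ.≤-refl
sumFin-mono-≤ {suc n} f≤g = ℚₚ.+-mono-≤ (f≤g zero) (sumFin-mono-≤ (f≤g ∘ suc))

sumFin-zero : ∀ {n} {f : Fin n → ℚ} → (∀ i → f i ≡ 0ℚ) → sumFin f ≡ 0ℚ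
sumFin-zero {n} {f} f≗0 rewrite sumFin≗∑ f = trans (∑.sum-cong-≗ f≗0) (∑.sum-replicate-zero n)

sumFin-supportedAt : ∀ {n} (f : Fin n → ℚ) k → (∀ i → i ≢ k → f i ≡ 0ℚ) → sumFin f ≡ f k
sumFin-supportedAt {suc n} f k f≗0 rewrite sumFin≗∑ f = begin
  ∑.sum f                     ≡⟨ ∑.sum-remove {i = k} f ⟩
  f k + ∑.sum (removeAt f k)  ≡⟨ cong (f k +_) removed≡0 ⟩
  f k + 0ℚ                    ≡⟨ ℚₚ.+-identityʳ (f k) ⟩
  f k                         ∎
  where
  open ≡-Reasoning
  removed≡0 : ∑.sum (removeAt f k) ≡ 0ℚ
  removed≡0 = trans (∑.sum-cong-≗ λ i → f≗0 _ (Finₚ.punchInᵢ≢i k i)) (∑.sum-replicate-zero n)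

𝟙 : ∀ {p} {P : Set p} → Dec P → ℚ
𝟙 P? = if does P? then 1ℚ else 0ℚ

𝟙*-≤ : ∀ {p} {P : Set p} (P? : Dec P) {x} → 0ℚ ≤ x → 𝟙 P? * x ≤ x
𝟙*-≤ (yes _) {x} _   = ℚₚ.≤-reflexive (ℚₚ.*-identityˡ x)
𝟙*-≤ (no _)  {x} 0≤x = subst (_≤ x) (sym (ℚₚ.*-zeroˡ x)) 0≤x

sumFin-𝟙 : ∀ {n} (p : Subset n) → sumFin (λ i → 𝟙 (i ∈? p)) ≡ ∣ p ∣ ×ℚ 1ℚ
sumFin-𝟙 []            = refl
sumFin-𝟙 (inside  ∷ p) = cong (1ℚ +_) (sumFin-𝟙 p)
sumFin-𝟙 (outside ∷ p) = trans (ℚₚ.+-identityˡ _) (sumFin-𝟙 p)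

+-cancelˡ-≤ : ∀ r {p q} → r + p ≤ r + q → p ≤ q
+-cancelˡ-≤ r {p} {q} r+p≤r+q = subst₂ _≤_ (cancel p) (cancel q) (ℚₚ.+-monoʳ-≤ (- r) r+p≤r+q)
  where
  cancel : ∀ x → - r + (r + x) ≡ x
  cancel x = trans (sym (ℚₚ.+-assoc (- r) r x)) (trans (cong (_+ x) (ℚₚ.+-inverseˡ r)) (ℚₚ.+-identityˡ x))

×1ℚ-nonNeg : ∀ n → 0ℚ ≤ n ×ℚ 1ℚ
×1ℚ-nonNeg zero    = ℚₚ.≤-refl
×1ℚ-nonNeg (suc n) = ℚₚ.+-mono-≤ (ℚₚ.nonNegative⁻¹ 1ℚ) (×1ℚ-nonNeg n)

×1ℚ-cancel-≤ : ∀ {m n} → m ×ℚ 1ℚ ≤ n ×ℚ 1ℚ → m ℕ.≤ n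
×1ℚ-cancel-≤ {zero}          _ = z≤n
×1ℚ-cancel-≤ {suc m} {zero}  1+m≤0 =
  contradiction (ℚₚ.<-≤-trans (ℚₚ.+-mono-<-≤ (ℚₚ.positive⁻¹ 1ℚ) (×1ℚ-nonNeg m)) 1+m≤0) (ℚₚ.<-irrefl refl)
×1ℚ-cancel-≤ {suc m} {suc n} 1+m≤1+n = s≤s (×1ℚ-cancel-≤ (+-cancelˡ-≤ 1ℚ 1+m≤1+n))

-- Hall's theorem

∣p∪q∣+∣p∩q∣≡∣p∣+∣q∣ : ∀ {n} (p q : Subset n) → ∣ p ∪ q ∣ ℕ.+ ∣ p ∩ q ∣ ≡ ∣ p ∣ ℕ.+ ∣ q ∣
∣p∪q∣+∣p∩q∣≡∣p∣+∣q∣ []            []            = refl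
∣p∪q∣+∣p∩q∣≡∣p∣+∣q∣ (inside  ∷ p) (inside  ∷ q) = cong suc (begin
  ∣ p ∪ q ∣ ℕ.+ suc ∣ p ∩ q ∣ ≡⟨ ℕₚ.+-suc _ _ ⟩
  suc (∣ p ∪ q ∣ ℕ.+ ∣ p ∩ q ∣) ≡⟨ cong suc (∣p∪q∣+∣p∩q∣≡∣p∣+∣q∣ p q) ⟩
  suc (∣ p ∣ ℕ.+ ∣ q ∣)         ≡⟨ ℕₚ.+-suc _ _ ⟨
  ∣ p ∣ ℕ.+ suc ∣ q ∣           ∎)
  where open ≡-Reasoning
∣p∪q∣+∣p∩q∣≡∣p∣+∣q∣ (inside  ∷ p) (outside ∷ q) = cong suc (∣p∪q∣+∣p∩q∣≡∣p∣+∣q∣ p q)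
∣p∪q∣+∣p∩q∣≡∣p∣+∣q∣ (outside ∷ p) (inside  ∷ q) =
  trans (cong suc (∣p∪q∣+∣p∩q∣≡∣p∣+∣q∣ p q)) (sym (ℕₚ.+-suc _ _))
∣p∪q∣+∣p∩q∣≡∣p∣+∣q∣ (outside ∷ p) (outside ∷ q) = ∣p∪q∣+∣p∩q∣≡∣p∣+∣q∣ p q

∣p∣≤1+∣p-x∣ : ∀ {n} (p : Subset n) x → ∣ p ∣ ℕ.≤ suc ∣ p - x ∣
∣p∣≤1+∣p-x∣ (inside  ∷ p) zero    = s≤s (ℕₚ.≤-reflexive (cong ∣_∣ (sym (p─⊥≡p p))))
∣p∣≤1+∣p-x∣ (outside ∷ p) zero    = ℕₚ.m≤n⇒m≤1+n (ℕₚ.≤-reflexive (cong ∣_∣ (sym (p─⊥≡p p))))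
∣p∣≤1+∣p-x∣ (inside  ∷ p) (suc x) = s≤s (∣p∣≤1+∣p-x∣ p x)
∣p∣≤1+∣p-x∣ (outside ∷ p) (suc x) = ∣p∣≤1+∣p-x∣ p x

x∉p-x : ∀ {n} (p : Subset n) x → x ∉ p - x
x∉p-x (s ∷ p) zero    ()
x∉p-x (s ∷ p) (suc x) x∈p-x = x∉p-x p x (drop-there x∈p-x)

∣p∣>0⇒nonempty : ∀ {n} {p : Subset n} → 0 ℕ.< ∣ p ∣ → Nonempty p
∣p∣>0⇒nonempty {n} {p} 0<∣p∣ = decidable-stable (nonempty? p) λ empty →
  ℕₚ.<⇒≢ 0<∣p∣ (sym (trans (cong ∣_∣ (Empty-unique empty)) (∣⊥∣≡0 n)))

subsetOf : ∀ {n} {P : Fin n → Set} → (∀ j → Dec (P j)) → Subset n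
subsetOf P? = tabulate (does ∘ P?)

∈-subsetOf⁺ : ∀ {n} {P : Fin n → Set} (P? : ∀ j → Dec (P j)) {j} → P j → j ∈ subsetOf P?
∈-subsetOf⁺ P? {j} pj = lookup⇒[]= j _ (trans (lookup∘tabulate (does ∘ P?) j) (dec-true (P? j) pj))

∈-subsetOf⁻ : ∀ {n} {P : Fin n → Set} (P? : ∀ j → Dec (P j)) {j} → j ∈ subsetOf P? → P j
∈-subsetOf⁻ P? {j} j∈ with P? j | trans (sym (lookup∘tabulate (does ∘ P?) j)) ([]=⇒lookup j∈)
... | yes pj | _  = pj
... | no _   | ()

Graph : ℕ → ℕ → Set
Graph n m = Fin n → Subset m

neighbours : ∀ {n m} → Graph n m → Subset n → Subset m
neighbours R []            = ⊥
neighbours R (inside  ∷ S) = R zero ∪ neighbours (R ∘ suc) S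
neighbours R (outside ∷ S) = neighbours (R ∘ suc) S

∈-neighbours⁺ : ∀ {n m} {R : Graph n m} {S i j} → i ∈ S → j ∈ R i → j ∈ neighbours R S
∈-neighbours⁺ {S = inside  ∷ S} here        j∈Ri = x∈p∪q⁺ (inj₁ j∈Ri)
∈-neighbours⁺ {S = inside  ∷ S} (there i∈S) j∈Ri = x∈p∪q⁺ (inj₂ (∈-neighbours⁺ i∈S j∈Ri))
∈-neighbours⁺ {S = outside ∷ S} (there i∈S) j∈Ri = ∈-neighbours⁺ i∈S j∈Ri

∈-neighbours⁻ : ∀ {n m} (R : Graph n m) S {j} → j ∈ neighbours R S → ∃[ i ] i ∈ S × j ∈ R i
∈-neighbours⁻ R []            j∈N = contradiction j∈N ∉⊥
∈-neighbours⁻ R (inside  ∷ S) j∈N with x∈p∪q⁻ (R zero) _ j∈N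
... | inj₁ j∈R₀ = zero , here , j∈R₀
... | inj₂ j∈N′ = let i , i∈S , j∈Ri = ∈-neighbours⁻ (R ∘ suc) S j∈N′ in suc i , there i∈S , j∈Ri
∈-neighbours⁻ R (outside ∷ S) j∈N =
  let i , i∈S , j∈Ri = ∈-neighbours⁻ (R ∘ suc) S j∈N in suc i , there i∈S , j∈Ri

Hall : ∀ {n m} → Graph n m → Set
Hall R = ∀ S → ∣ S ∣ ℕ.≤ ∣ neighbours R S ∣

Deficient : ∀ {n m} → Graph n m → Subset n → Set
Deficient R S = ∣ neighbours R S ∣ ℕ.< ∣ S ∣

hall⊎deficient : ∀ {n m} (R : Graph n m) → Hall R ⊎ ∃ (Deficient R)
hall⊎deficient R with anySubset? (λ S → ∣ neighbours R S ∣ ℕ.<? ∣ S ∣)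
... | yes deficient = inj₂ deficient
... | no ¬deficient = inj₁ λ S → ℕₚ.≮⇒≥ λ N<S → ¬deficient (S , N<S)

Matching : ∀ {n m} → Graph n m → Set
Matching {n} {m} R = Σ (Fin n → Fin m) λ f → Injective _≡_ _≡_ f × (∀ i → f i ∈ R i)

Matching-⊆ : ∀ {n m} {R R′ : Graph n m} → (∀ i → R′ i ⊆ R i) → Matching R′ → Matching R
Matching-⊆ R′⊆R (f , f-injective , f∈R′) = f , f-injective , λ i → R′⊆R i (f∈R′ i)

deleteEdge : ∀ {n m} → Graph n m → Fin n → Fin m → Graph n m
deleteEdge R i j = updateAt R i (_- j)

module _ {n m} (R : Graph n m) (i : Fin n) (j : Fin m) where

  deleteEdge-⊆ : ∀ a → deleteEdge R i j a ⊆ R a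
  deleteEdge-⊆ a with a ≟ i
  ... | yes refl = subst (_⊆ R i) (sym (updateAt-updates i R)) (p─q⊆p (R i) ⁅ j ⁆)
  ... | no a≢i   = subst (_⊆ R a) (sym (updateAt-minimal a i R a≢i)) id

  deleteEdge-keeps : ∀ {a b} → a ≢ i ⊎ b ≢ j → b ∈ R a → b ∈ deleteEdge R i j a
  deleteEdge-keeps {a} {b} other b∈Ra with a ≟ i | other
  ... | yes refl | inj₁ i≢i = contradiction refl i≢i
  ... | yes refl | inj₂ b≢j = subst (b ∈_) (sym (updateAt-updates i R)) (x∈p∧x≢y⇒x∈p-y b∈Ra b≢j)
  ... | no a≢i   | _        = subst (b ∈_) (sym (updateAt-minimal a i R a≢i)) b∈Ra

edgeCount : ∀ {n m} → Graph n m → ℕ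
edgeCount R = ∑ℕ.sum (λ i → ∣ R i ∣)

edgeCount-deleteEdge : ∀ {n m} (R : Graph n m) {i j} → j ∈ R i →
                       edgeCount (deleteEdge R i j) ℕ.< edgeCount R
edgeCount-deleteEdge {suc n} R {i} {j} j∈Ri = begin-strict
  edgeCount (deleteEdge R i j)                     ≡⟨ ∑ℕ.sum-remove {i = i} (∣_∣ ∘ deleteEdge R i j) ⟩
  ∣ deleteEdge R i j i ∣ ℕ.+ ∑ℕ.sum (removeAt (∣_∣ ∘ deleteEdge R i j) i)
    ≡⟨ cong₂ ℕ._+_ (cong ∣_∣ (updateAt-updates i R))
                   (∑ℕ.sum-cong-≗ λ k → cong ∣_∣ (updateAt-minimal (punchIn i k) i R (Finₚ.punchInᵢ≢i i k))) ⟩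
  ∣ R i - j ∣ ℕ.+ ∑ℕ.sum (removeAt (∣_∣ ∘ R) i)    <⟨ ℕₚ.+-monoˡ-< _ (x∈p⇒∣p-x∣<∣p∣ j∈Ri) ⟩
  ∣ R i ∣ ℕ.+ ∑ℕ.sum (removeAt (∣_∣ ∘ R) i)        ≡⟨ ∑ℕ.sum-remove {i = i} (∣_∣ ∘ R) ⟨
  edgeCount R                                      ∎
  where open ℕₚ.≤-Reasoning

module _ {n m} {R : Graph n m} {i : Fin n} where

  ∈-neighbours-deleteEdge-∪ : ∀ {j j′ S S′ a b} → j ≢ j′ → i ∈ S′ → a ∈ S → b ∈ R a →
                              b ∈ neighbours (deleteEdge R i j) S ∪ neighbours (deleteEdge R i j′) S′
  ∈-neighbours-deleteEdge-∪ {j} {j′} {a = a} {b} j≢j′ i∈S′ a∈S b∈Ra with a ≟ i | b ≟ j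
  ... | yes refl | yes refl = x∈p∪q⁺ (inj₂ (∈-neighbours⁺ i∈S′ (deleteEdge-keeps R i j′ (inj₂ j≢j′) b∈Ra)))
  ... | no a≢i   | _        = x∈p∪q⁺ (inj₁ (∈-neighbours⁺ a∈S (deleteEdge-keeps R i j (inj₁ a≢i) b∈Ra)))
  ... | yes _    | no b≢j   = x∈p∪q⁺ (inj₁ (∈-neighbours⁺ a∈S (deleteEdge-keeps R i j (inj₂ b≢j) b∈Ra)))

  module _ (hall : Hall R) where

    deficient-deleteEdge⇒∈ : ∀ {j S} → Deficient (deleteEdge R i j) S → i ∈ S
    deficient-deleteEdge⇒∈ {j} {S} deficient = decidable-stable (i ∈? S) λ i∉S →
      ℕₚ.<-irrefl refl (ℕₚ.<-≤-trans deficient (ℕₚ.≤-trans (hall S) (p⊆q⇒∣p∣≤∣q∣ (N⊆N′ i∉S))))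
      where
      N⊆N′ : i ∉ S → neighbours R S ⊆ neighbours (deleteEdge R i j) S
      N⊆N′ i∉S b∈N with ∈-neighbours⁻ R S b∈N
      ... | a , a∈S , b∈Ra = ∈-neighbours⁺ a∈S (deleteEdge-keeps R i j (inj₁ λ { refl → i∉S a∈S }) b∈Ra)

    module _ {j₁ j₂ : Fin m} (j₁≢j₂ : j₁ ≢ j₂) where

      private
        R₁ = deleteEdge R i j₁
        R₂ = deleteEdge R i j₂

      neighbours-∪-⊆ : ∀ {S₁ S₂} → i ∈ S₁ → i ∈ S₂ →
                       neighbours R (S₁ ∪ S₂) ⊆ neighbours R₁ S₁ ∪ neighbours R₂ S₂
      neighbours-∪-⊆ {S₁} {S₂} i∈S₁ i∈S₂ b∈N with ∈-neighbours⁻ R (S₁ ∪ S₂) b∈N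
      ... | a , a∈S₁∪S₂ , b∈Ra with x∈p∪q⁻ S₁ S₂ a∈S₁∪S₂
      ...   | inj₁ a∈S₁ = ∈-neighbours-deleteEdge-∪ j₁≢j₂ i∈S₂ a∈S₁ b∈Ra
      ...   | inj₂ a∈S₂ = x∈p∪q⁺ (swap (x∈p∪q⁻ _ _ (∈-neighbours-deleteEdge-∪ (j₁≢j₂ ∘ sym) i∈S₁ a∈S₂ b∈Ra)))

      neighbours-∩-⊆ : ∀ S₁ S₂ → neighbours R ((S₁ ∩ S₂) - i) ⊆ neighbours R₁ S₁ ∩ neighbours R₂ S₂
      neighbours-∩-⊆ S₁ S₂ b∈N with ∈-neighbours⁻ R ((S₁ ∩ S₂) - i) b∈N
      ... | a , a∈T , b∈Ra =
        let a∈S₁ , a∈S₂ = x∈p∩q⁻ S₁ S₂ (p─q⊆p (S₁ ∩ S₂) ⁅ i ⁆ a∈T)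
            a≢i : a ≢ i
            a≢i = λ { refl → x∉p-x (S₁ ∩ S₂) i a∈T }
        in x∈p∩q⁺ ( ∈-neighbours⁺ a∈S₁ (deleteEdge-keeps R i j₁ (inj₁ a≢i) b∈Ra)
                  , ∈-neighbours⁺ a∈S₂ (deleteEdge-keeps R i j₂ (inj₁ a≢i) b∈Ra))

      -- Deficient sets S₁, S₂ for the two deletions both contain i. Hall's condition in R for
      -- S₁ ∪ S₂ and (S₁ ∩ S₂) - i, whose neighbourhoods lie in N₁ ∪ N₂ and N₁ ∩ N₂, then gives
      -- ∣S₁∣ + ∣S₂∣ ≤ ∣N₁∣ + ∣N₂∣ + 1, contradicting deficiency.
      hall-deleteEdge : Hall R₁ ⊎ Hall R₂
      hall-deleteEdge with hall⊎deficient R₁ | hall⊎deficient R₂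
      ... | inj₁ hall₁       | _                = inj₁ hall₁
      ... | inj₂ _           | inj₁ hall₂       = inj₂ hall₂
      ... | inj₂ (S₁ , d₁)   | inj₂ (S₂ , d₂)   = contradiction counting (ℕₚ.<⇒≱ deficiency)
        where
        N₁ = neighbours R₁ S₁
        N₂ = neighbours R₂ S₂
        i∈S₁ = deficient-deleteEdge⇒∈ {j₁} {S₁} d₁
        i∈S₂ = deficient-deleteEdge⇒∈ {j₂} {S₂} d₂

        deficiency : suc (∣ N₁ ∣ ℕ.+ ∣ N₂ ∣) ℕ.< ∣ S₁ ∣ ℕ.+ ∣ S₂ ∣
        deficiency = subst (ℕ._≤ ∣ S₁ ∣ ℕ.+ ∣ S₂ ∣) (ℕₚ.+-suc (suc ∣ N₁ ∣) ∣ N₂ ∣) (ℕₚ.+-mono-≤ d₁ d₂)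

        counting : ∣ S₁ ∣ ℕ.+ ∣ S₂ ∣ ℕ.≤ suc (∣ N₁ ∣ ℕ.+ ∣ N₂ ∣)
        counting = begin
          ∣ S₁ ∣ ℕ.+ ∣ S₂ ∣
            ≡⟨ ∣p∪q∣+∣p∩q∣≡∣p∣+∣q∣ S₁ S₂ ⟨
          ∣ S₁ ∪ S₂ ∣ ℕ.+ ∣ S₁ ∩ S₂ ∣
            ≤⟨ ℕₚ.+-monoʳ-≤ _ (∣p∣≤1+∣p-x∣ (S₁ ∩ S₂) i) ⟩
          ∣ S₁ ∪ S₂ ∣ ℕ.+ suc ∣ (S₁ ∩ S₂) - i ∣
            ≤⟨ ℕₚ.+-mono-≤ (hall (S₁ ∪ S₂)) (s≤s (hall ((S₁ ∩ S₂) - i))) ⟩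
          ∣ neighbours R (S₁ ∪ S₂) ∣ ℕ.+ suc ∣ neighbours R ((S₁ ∩ S₂) - i) ∣
            ≤⟨ ℕₚ.+-mono-≤ (p⊆q⇒∣p∣≤∣q∣ (neighbours-∪-⊆ i∈S₁ i∈S₂))
                           (s≤s (p⊆q⇒∣p∣≤∣q∣ (neighbours-∩-⊆ S₁ S₂))) ⟩
          ∣ N₁ ∪ N₂ ∣ ℕ.+ suc ∣ N₁ ∩ N₂ ∣
            ≡⟨ ℕₚ.+-suc _ _ ⟩
          suc (∣ N₁ ∪ N₂ ∣ ℕ.+ ∣ N₁ ∩ N₂ ∣)
            ≡⟨ cong suc (∣p∪q∣+∣p∩q∣≡∣p∣+∣q∣ N₁ N₂) ⟩
          suc (∣ N₁ ∣ ℕ.+ ∣ N₂ ∣)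
            ∎
          where open ℕₚ.≤-Reasoning

module _ {n m} {R : Graph n m} (hall : Hall R) where

  hall⇒neighbour : ∀ i → ∃[ j ] j ∈ R i
  hall⇒neighbour i with ∣p∣>0⇒nonempty (ℕₚ.≤-trans (ℕₚ.≤-reflexive (sym (∣⁅x⁆∣≡1 i))) (hall ⁅ i ⁆))
  ... | j , j∈N with ∈-neighbours⁻ R ⁅ i ⁆ j∈N
  ... | a , a∈⁅i⁆ , j∈Ra = j , subst (λ a → j ∈ R a) (x∈⁅y⁆⇒x≡y i a∈⁅i⁆) j∈Ra

  uniqueNeighbours⇒matching : (∀ {i j j′} → j ∈ R i → j′ ∈ R i → j ≡ j′) → Matching R
  uniqueNeighbours⇒matching unique = f , f-injective , proj₂ ∘ hall⇒neighbour
    where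
    f : Fin n → Fin m
    f = proj₁ ∘ hall⇒neighbour

    f-injective : Injective _≡_ _≡_ f
    f-injective {a} {b} fa≡fb = decidable-stable (a ≟ b) λ a≢b → ℕₚ.<⇒≱ (1<∣S∣ a≢b) ∣S∣≤1
      where
      S = ⁅ a ⁆ ∪ ⁅ b ⁆

      1<∣S∣ : a ≢ b → 1 ℕ.< ∣ S ∣
      1<∣S∣ a≢b = subst (ℕ._< ∣ S ∣) (∣⁅x⁆∣≡1 a)
        (p⊂q⇒∣p∣<∣q∣ (p⊆p∪q ⁅ b ⁆ , b , x∈p∪q⁺ (inj₂ (x∈⁅x⁆ b)) , x≢y⇒x∉⁅y⁆ (a≢b ∘ sym)))

      fa≡ : ∀ {x c} → x ∈ S → c ∈ R x → f a ≡ c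
      fa≡ x∈S c∈Rx with x∈p∪q⁻ ⁅ a ⁆ ⁅ b ⁆ x∈S
      ... | inj₁ x∈⁅a⁆ with refl ← x∈⁅y⁆⇒x≡y a x∈⁅a⁆ = unique (proj₂ (hall⇒neighbour a)) c∈Rx
      ... | inj₂ x∈⁅b⁆ with refl ← x∈⁅y⁆⇒x≡y b x∈⁅b⁆ = trans fa≡fb (unique (proj₂ (hall⇒neighbour b)) c∈Rx)

      N⊆⁅fa⁆ : neighbours R S ⊆ ⁅ f a ⁆
      N⊆⁅fa⁆ c∈N = let x , x∈S , c∈Rx = ∈-neighbours⁻ R S c∈N
                   in subst (_∈ ⁅ f a ⁆) (fa≡ x∈S c∈Rx) (x∈⁅x⁆ (f a))

      ∣S∣≤1 : ∣ S ∣ ℕ.≤ 1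
      ∣S∣≤1 = ℕₚ.≤-trans (hall S) (subst (∣ neighbours R S ∣ ℕ.≤_) (∣⁅x⁆∣≡1 (f a)) (p⊆q⇒∣p∣≤∣q∣ N⊆⁅fa⁆))

TwoNeighbours : ∀ {n m} → Graph n m → Set
TwoNeighbours {n} {m} R = ∃[ i ] ∃₂ λ (j₁ j₂ : Fin m) → j₁ ≢ j₂ × j₁ ∈ R i × j₂ ∈ R i

twoNeighbours? : ∀ {n m} (R : Graph n m) → Dec (TwoNeighbours R)
twoNeighbours? R = Finₚ.any? λ i → Finₚ.any? λ j₁ → Finₚ.any? λ j₂ →
  ¬? (j₁ ≟ j₂) ×-dec j₁ ∈? R i ×-dec j₂ ∈? R i

hall⇒matching : ∀ {n m} (R : Graph n m) → Hall R → Matching R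
hall⇒matching R = go R (<-wellFounded (edgeCount R))
  where
  go : ∀ {n m} (R : Graph n m) → Acc ℕ._<_ (edgeCount R) → Hall R → Matching R
  go R (acc smaller) hall with twoNeighbours? R
  ... | no ¬two = uniqueNeighbours⇒matching hall unique
    where
    unique : ∀ {i j j′} → j ∈ R i → j′ ∈ R i → j ≡ j′
    unique {i} {j} {j′} j∈ j′∈ = decidable-stable (j ≟ j′) λ j≢j′ → ¬two (i , j , j′ , j≢j′ , j∈ , j′∈)
  ... | yes (i , j₁ , j₂ , j₁≢j₂ , j₁∈ , j₂∈) with hall-deleteEdge hall j₁≢j₂
  ...   | inj₁ hall₁ = Matching-⊆ (deleteEdge-⊆ R i j₁) (go _ (smaller (edgeCount-deleteEdge R j₁∈)) hall₁)
  ...   | inj₂ hall₂ = Matching-⊆ (deleteEdge-⊆ R i j₂) (go _ (smaller (edgeCount-deleteEdge R j₂∈)) hall₂)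

injective⇒surjective : ∀ {n} {f : Fin n → Fin n} → Injective _≡_ _≡_ f → ∀ j → ∃[ i ] f i ≡ j
injective⇒surjective {suc n} {f} f-injective j = decidable-stable (Finₚ.any? λ i → f i ≟ j) λ ¬hit →
  let missed : ∀ i → j ≢ f i
      missed i j≡fi = ¬hit (i , sym j≡fi)
  in ℕₚ.1+n≰n (Finₚ.injective⇒≤ {f = λ i → punchOut (missed i)}
                 λ {a} {b} → f-injective ∘ Finₚ.punchOut-injective (missed a) (missed b))

injective⇒permutation : ∀ {n} {f : Fin n → Fin n} → Injective _≡_ _≡_ f →
                        Σ (Permutation′ n) λ σ → ∀ i → σ ⟨$⟩ʳ i ≡ f i
injective⇒permutation {f = f} f-injective =
  permutation f (proj₁ ∘ surjective) (proj₂ ∘ surjective) (λ i → f-injective (proj₂ (surjective (f i)))) ,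
  λ _ → refl
  where surjective = injective⇒surjective f-injective

-- Doubly stochastic matrices

support : ∀ {n} → Mat n → Graph n n
support A i = subsetOf λ j → 0ℚ <? A i j

∈-support⁺ : ∀ {n} {A : Mat n} {i j} → 0ℚ < A i j → j ∈ support A i
∈-support⁺ {A = A} {i} = ∈-subsetOf⁺ (λ j → 0ℚ <? A i j)

∈-support⁻ : ∀ {n} {A : Mat n} {i j} → j ∈ support A i → 0ℚ < A i j
∈-support⁻ {A = A} {i} = ∈-subsetOf⁻ (λ j → 0ℚ <? A i j)

doublyStochastic⇒hall : ∀ {n} {A : Mat n} → DoublyStochastic A → Hall (support A)
doublyStochastic⇒hall {n} {A} (nonNeg , rows , cols) S = ×1ℚ-cancel-≤ (begin
  ∣ S ∣ ×ℚ 1ℚ                                          ≡⟨ sumFin-𝟙 S ⟨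
  sumFin (λ i → 𝟙 (i ∈? S))                           ≡⟨ sumFin-cong (λ i → ℚₚ.*-identityʳ (𝟙 (i ∈? S))) ⟨
  sumFin (λ i → 𝟙 (i ∈? S) * 1ℚ)                      ≡⟨ sumFin-cong (λ i → cong (𝟙 (i ∈? S) *_) (rows i)) ⟨
  sumFin (λ i → 𝟙 (i ∈? S) * sumFin (A i))            ≡⟨ sumFin-cong (λ i → sumFin-* (𝟙 (i ∈? S)) (A i)) ⟨
  sumFin (λ i → sumFin (λ j → 𝟙 (i ∈? S) * A i j))    ≡⟨ sumFin-comm (λ i j → 𝟙 (i ∈? S) * A i j) ⟩
  sumFin (λ j → sumFin (λ i → 𝟙 (i ∈? S) * A i j))    ≤⟨ sumFin-mono-≤ column-bound ⟩
  sumFin (λ j → 𝟙 (j ∈? N))                           ≡⟨ sumFin-𝟙 N ⟩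
  ∣ N ∣ ×ℚ 1ℚ                                          ∎)
  where
  open ℚₚ.≤-Reasoning
  N = neighbours (support A) S
  column-bound : ∀ j → sumFin (λ i → 𝟙 (i ∈? S) * A i j) ≤ 𝟙 (j ∈? N)
  column-bound j with j ∈? N
  ... | yes _  = ℚₚ.≤-trans (sumFin-mono-≤ (λ i → 𝟙*-≤ (i ∈? S) (nonNeg i j))) (ℚₚ.≤-reflexive (cols j))
  ... | no j∉N = ℚₚ.≤-reflexive (sumFin-zero term-zero)
    where
    term-zero : ∀ i → 𝟙 (i ∈? S) * A i j ≡ 0ℚ
    term-zero i with i ∈? S
    ... | no _    = ℚₚ.*-zeroˡ (A i j)
    ... | yes i∈S = trans (ℚₚ.*-identityˡ (A i j))
      (ℚₚ.≤-antisym (ℚₚ.≮⇒≥ λ pos → j∉N (∈-neighbours⁺ i∈S (∈-support⁺ {A = A} pos))) (nonNeg i j))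

doublyStochastic⇒positiveDiagonal : ∀ {n} {A : Mat n} → DoublyStochastic A →
                                    Σ (Permutation′ n) λ σ → ∀ i → 0ℚ < A i (σ ⟨$⟩ʳ i)
doublyStochastic⇒positiveDiagonal {A = A} ds =
  let f , f-injective , f∈support = hall⇒matching (support A) (doublyStochastic⇒hall ds)
      σ , σ≗f = injective⇒permutation f-injective
  in σ , λ i → subst (λ j → 0ℚ < A i j) (sym (σ≗f i)) (∈-support⁻ {A = A} (f∈support i))

ᵖ-involutive : ∀ {n} (A : Mat n) → ((A ᵖ) ᵖ) ≐ A
ᵖ-involutive A i j = cong₂ A (Finₚ.opposite-involutive i) (Finₚ.opposite-involutive j)

½*[x+x]≡x : ∀ x → ½ * (x + x) ≡ x
½*[x+x]≡x = solve 1 (λ x → con ½ :* (x :+ x) := x) refl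

½*-mono-+-≤ : ∀ {a b c d} → a ≤ c → b ≤ d → ½ * (a + b) ≤ ½ * (c + d)
½*-mono-+-≤ a≤c b≤d = ℚₚ.*-monoˡ-≤-nonNeg ½ (ℚₚ.+-mono-≤ a≤c b≤d)

0≤½*[x+y] : ∀ {x y} → 0ℚ ≤ x → 0ℚ ≤ y → 0ℚ ≤ ½ * (x + y)
0≤½*[x+y] 0≤x 0≤y = ℚₚ.≤-trans (ℚₚ.≤-reflexive (sym (½*[x+x]≡x 0ℚ))) (½*-mono-+-≤ 0≤x 0≤y)

ᵗ-doublyStochastic : ∀ {n} {A : Mat n} → DoublyStochastic A → DoublyStochastic (A ᵗ)
ᵗ-doublyStochastic (nonNeg , rows , cols) = (λ i j → nonNeg j i) , cols , rows

ᵖ-doublyStochastic : ∀ {n} {A : Mat n} → DoublyStochastic A → DoublyStochastic (A ᵖ)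
ᵖ-doublyStochastic {A = A} (nonNeg , rows , cols) =
  (λ i j → nonNeg (opposite i) (opposite j)) ,
  (λ i → trans (sumFin-opposite (A (opposite i))) (rows (opposite i))) ,
  (λ j → trans (sumFin-opposite (λ i → A i (opposite j))) (cols (opposite j)))

average-doublyStochastic : ∀ {n} {A B : Mat n} → DoublyStochastic A → DoublyStochastic B →
                           DoublyStochastic (½ • (A ⊕ B))
average-doublyStochastic {A = A} {B} (nonNegA , rowsA , colsA) (nonNegB , rowsB , colsB) =
  (λ i j → 0≤½*[x+y] (nonNegA i j) (nonNegB i j)) ,
  (λ i → average-sum (A i) (B i) (rowsA i) (rowsB i)) ,
  (λ j → average-sum (λ i → A i j) (λ i → B i j) (colsA j) (colsB j))
  where
  average-sum : ∀ f g → sumFin f ≡ 1ℚ → sumFin g ≡ 1ℚ → sumFin (λ k → ½ * (f k + g k)) ≡ 1ℚ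
  average-sum f g Σf≡1 Σg≡1 = begin
    sumFin (λ k → ½ * (f k + g k)) ≡⟨ sumFin-* ½ (λ k → f k + g k) ⟩
    ½ * sumFin (λ k → f k + g k)   ≡⟨ cong (½ *_) (sumFin-+ f g) ⟩
    ½ * (sumFin f + sumFin g)      ≡⟨ cong₂ (λ x y → ½ * (x + y)) Σf≡1 Σg≡1 ⟩
    ½ * (1ℚ + 1ℚ)                  ≡⟨ ½*[x+x]≡x 1ℚ ⟩
    1ℚ                             ∎
    where open ≡-Reasoning

module _ {n} (σ : Permutation′ n) where

  permMat-≡ : ∀ {i j} → σ ⟨$⟩ʳ i ≡ j → permMat σ i j ≡ 1ℚ
  permMat-≡ {i} {j} σi≡j with σ ⟨$⟩ʳ i ≟ j
  ... | yes _    = refl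
  ... | no σi≢j = contradiction σi≡j σi≢j

  permMat-≢ : ∀ {i j} → σ ⟨$⟩ʳ i ≢ j → permMat σ i j ≡ 0ℚ
  permMat-≢ {i} {j} σi≢j with σ ⟨$⟩ʳ i ≟ j
  ... | yes σi≡j = contradiction σi≡j σi≢j
  ... | no _     = refl

  permMat-doublyStochastic : DoublyStochastic (permMat σ)
  permMat-doublyStochastic = nonNeg , rows , cols
    where
    nonNeg : ∀ i j → 0ℚ ≤ permMat σ i j
    nonNeg i j with σ ⟨$⟩ʳ i ≟ j
    ... | yes _ = ℚₚ.nonNegative⁻¹ 1ℚ
    ... | no _  = ℚₚ.≤-refl
    rows : ∀ i → sumFin (permMat σ i) ≡ 1ℚ
    rows i = trans (sumFin-supportedAt (permMat σ i) (σ ⟨$⟩ʳ i) (λ j j≢σi → permMat-≢ (j≢σi ∘ sym)))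
                   (permMat-≡ refl)
    cols : ∀ j → sumFin (λ i → permMat σ i j) ≡ 1ℚ
    cols j = trans (sumFin-supportedAt (λ i → permMat σ i j) (σ ⟨$⟩ˡ j)
                     (λ i i≢σ⁻¹j → permMat-≢ λ σi≡j → i≢σ⁻¹j (trans (sym (inverseˡ σ)) (cong (σ ⟨$⟩ˡ_) σi≡j))))
                   (permMat-≡ (inverseʳ σ))

  permMat-dominated : ∀ {A : Mat n} {t} → (∀ i j → 0ℚ ≤ A i j) → (∀ i → t ≤ A i (σ ⟨$⟩ʳ i)) →
                      ∀ i j → t * permMat σ i j ≤ A i j
  permMat-dominated {A} {t} nonNeg t≤diagonal i j with σ ⟨$⟩ʳ i ≟ j
  ... | yes refl = subst (_≤ A i j) (sym (ℚₚ.*-identityʳ t)) (t≤diagonal i)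
  ... | no _     = subst (_≤ A i j) (sym (ℚₚ.*-zeroʳ t)) (nonNeg i j)

-- Symmetrisation

centroAverage : ∀ {n} → Mat n → Mat n
centroAverage A = ½ • (A ⊕ (A ᵖ))

symmetrise : ∀ {n} → Mat n → Mat n
symmetrise A = ½ • (centroAverage A ⊕ (centroAverage A ᵗ))

centroAverage-centrosymmetric : ∀ {n} (A : Mat n) → Centrosymmetric (centroAverage A)
centroAverage-centrosymmetric A i j =
  cong (½ *_) (trans (cong (Aᵖ i j +_) (ᵖ-involutive A i j)) (ℚₚ.+-comm (Aᵖ i j) (A i j)))
  where Aᵖ = A ᵖ

symmetrise-symmetric : ∀ {n} (A : Mat n) → Symmetric (symmetrise A)
symmetrise-symmetric A i j = cong (½ *_) (ℚₚ.+-comm (centroAverage A j i) (centroAverage A i j))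

symmetrise-hankelSymmetric : ∀ {n} (A : Mat n) → HankelSymmetric (symmetrise A)
symmetrise-hankelSymmetric A i j =
  cong (½ *_) (trans (cong₂ _+_ (R-centro j i) (R-centro i j)) (ℚₚ.+-comm (R j i) (R i j)))
  where
  R = centroAverage A
  R-centro = centroAverage-centrosymmetric A

symmetrise-inΩth : ∀ {n} {A : Mat n} → DoublyStochastic A → InΩth (symmetrise A)
symmetrise-inΩth {A = A} ds = average-doublyStochastic dsR (ᵗ-doublyStochastic dsR) ,
                              symmetrise-symmetric A , symmetrise-hankelSymmetric A
  where dsR = average-doublyStochastic ds (ᵖ-doublyStochastic ds)

symmetrise-fixes : ∀ {n} {A : Mat n} → Symmetric A → HankelSymmetric A → symmetrise A ≐ A
symmetrise-fixes {A = A} symA hankelA i j = begin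
  ½ * (R i j + R j i)         ≡⟨ cong (½ *_) (cong₂ _+_ (R≐A i j) (trans (R≐A j i) (symA i j))) ⟩
  ½ * (A i j + A i j)         ≡⟨ ½*[x+x]≡x (A i j) ⟩
  A i j                       ∎
  where
  open ≡-Reasoning
  R = centroAverage A
  R≐A : R ≐ A
  R≐A i j = trans (cong (λ x → ½ * (A i j + x)) (trans (hankelA j i) (symA i j))) (½*[x+x]≡x (A i j))

symmetrise-mono-≤ : ∀ {n} {A B : Mat n} → (∀ i j → A i j ≤ B i j) →
                    ∀ i j → symmetrise A i j ≤ symmetrise B i j
symmetrise-mono-≤ {A = A} {B} A≤B i j = ½*-mono-+-≤ (centro-mono i j) (centro-mono j i)
  where
  centro-mono : ∀ i j → centroAverage A i j ≤ centroAverage B i j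
  centro-mono i j = ½*-mono-+-≤ (A≤B i j) (A≤B (opposite i) (opposite j))

symmetrise-• : ∀ {n} t (A : Mat n) → symmetrise (t • A) ≐ (t • symmetrise A)
symmetrise-• t A i j = solve 5 (λ t a b c d →
    con ½ :* (con ½ :* (t :* a :+ t :* b) :+ con ½ :* (t :* c :+ t :* d))
  := t :* (con ½ :* (con ½ :* (a :+ b) :+ con ½ :* (c :+ d)))) refl
  t (A i j) (A (opposite i) (opposite j)) (A j i) (A (opposite j) (opposite i))

symmetrise-≐-quarterSum : ∀ {n} (A : Mat n) → symmetrise A ≐ ((½ * ½) • (((A ⊕ (A ᵗ)) ⊕ (A ʰ)) ⊕ (A ᵖ)))
symmetrise-≐-quarterSum A i j = solve 4 (λ a b c d →
    con ½ :* (con ½ :* (a :+ b) :+ con ½ :* (c :+ d))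
  := (con ½ :* con ½) :* (((a :+ c) :+ d) :+ b)) refl
  (A i j) (A (opposite i) (opposite j)) (A j i) (A (opposite j) (opposite i))

symmetrise-dominated : ∀ {n} {A B : Mat n} {t} → Symmetric A → HankelSymmetric A →
                       (∀ i j → t * B i j ≤ A i j) → ∀ i j → t * symmetrise B i j ≤ A i j
symmetrise-dominated {A = A} {B} {t} symA hankelA tB≤A i j = begin
  t * symmetrise B i j   ≡⟨ symmetrise-• t B i j ⟨
  symmetrise (t • B) i j ≤⟨ symmetrise-mono-≤ tB≤A i j ⟩
  symmetrise A i j       ≡⟨ symmetrise-fixes symA hankelA i j ⟩
  A i j                  ∎
  where open ℚₚ.≤-Reasoning

-- Extreme points

module _ {n} (A B : Mat n) {t : ℚ} (t<1 : t < 1ℚ) where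

  private
    0<1-t : 0ℚ < 1ℚ ℚ.- t
    0<1-t = subst (_< 1ℚ ℚ.- t) (ℚₚ.+-inverseʳ t) (ℚₚ.+-monoˡ-< (- t) t<1)

    instance
      1-t-positive : ℚ.Positive (1ℚ ℚ.- t)
      1-t-positive = ℚ.positive 0<1-t

      1-t-nonZero : ℚ.NonZero (1ℚ ℚ.- t)
      1-t-nonZero = ℚₚ.pos⇒nonZero (1ℚ ℚ.- t)

    1/[1-t] : ℚ
    1/[1-t] = 1/ (1ℚ ℚ.- t)

    instance
      1/[1-t]-nonNegative : ℚ.NonNegative 1/[1-t]
      1/[1-t]-nonNegative = ℚₚ.pos⇒nonNeg 1/[1-t] {{ℚₚ.1/pos⇒pos (1ℚ ℚ.- t)}}

  residual : Mat n
  residual = 1/[1-t] • (A ⊕ ((- t) • B))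

  residual-decomposes : A ≐ ((t • B) ⊕ ((1ℚ ℚ.- t) • residual))
  residual-decomposes i j = sym (begin
    t * B i j + (1ℚ ℚ.- t) * (1/[1-t] * (A i j + (- t) * B i j))
      ≡⟨ cong (t * B i j +_) (ℚₚ.*-assoc (1ℚ ℚ.- t) 1/[1-t] x) ⟨
    t * B i j + ((1ℚ ℚ.- t) * 1/[1-t]) * (A i j + (- t) * B i j)
      ≡⟨ cong (λ c → t * B i j + c * x) (ℚₚ.*-inverseʳ (1ℚ ℚ.- t)) ⟩
    t * B i j + 1ℚ * (A i j + (- t) * B i j)
      ≡⟨ solve 3 (λ t a b → t :* b :+ con 1ℚ :* (a :+ (:- t) :* b) := a) refl t (A i j) (B i j) ⟩
    A i j ∎)
    where
    open ≡-Reasoning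
    x = A i j + (- t) * B i j

  residual-inΩth : InΩth A → InΩth B → (∀ i j → t * B i j ≤ A i j) → InΩth residual
  residual-inΩth ((_ , rowsA , colsA) , symA , hankelA) ((_ , rowsB , colsB) , symB , hankelB) tB≤A =
    (nonNeg , (λ i → residual-sum (rowsA i) (rowsB i)) , (λ j → residual-sum (colsA j) (colsB j))) ,
    (λ i j → cong₂ (λ a b → 1/[1-t] * (a + (- t) * b)) (symA i j) (symB i j)) ,
    (λ i j → cong₂ (λ a b → 1/[1-t] * (a + (- t) * b)) (hankelA i j) (hankelB i j))
    where
    0≤A-tB : ∀ i j → 0ℚ ≤ A i j + (- t) * B i j
    0≤A-tB i j = subst (_≤ A i j + (- t) * B i j)
      (solve 2 (λ t b → t :* b :+ (:- t) :* b := con 0ℚ) refl t (B i j))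
      (ℚₚ.+-monoˡ-≤ ((- t) * B i j) (tB≤A i j))

    nonNeg : ∀ i j → 0ℚ ≤ residual i j
    nonNeg i j = subst (_≤ residual i j) (ℚₚ.*-zeroʳ 1/[1-t]) (ℚₚ.*-monoˡ-≤-nonNeg 1/[1-t] (0≤A-tB i j))

    residual-sum : ∀ {f g : Fin n → ℚ} → sumFin f ≡ 1ℚ → sumFin g ≡ 1ℚ →
                   sumFin (λ k → 1/[1-t] * (f k + (- t) * g k)) ≡ 1ℚ
    residual-sum {f} {g} Σf≡1 Σg≡1 = begin
      sumFin (λ k → 1/[1-t] * (f k + (- t) * g k))
        ≡⟨ sumFin-* 1/[1-t] (λ k → f k + (- t) * g k) ⟩
      1/[1-t] * sumFin (λ k → f k + (- t) * g k)
        ≡⟨ cong (1/[1-t] *_) (trans (sumFin-+ f (λ k → (- t) * g k)) (cong (sumFin f +_) (sumFin-* (- t) g))) ⟩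
      1/[1-t] * (sumFin f + (- t) * sumFin g)
        ≡⟨ cong₂ (λ x y → 1/[1-t] * (x + (- t) * y)) Σf≡1 Σg≡1 ⟩
      1/[1-t] * (1ℚ + (- t) * 1ℚ)
        ≡⟨ cong (λ x → 1/[1-t] * (1ℚ + x)) (ℚₚ.*-identityʳ (- t)) ⟩
      1/[1-t] * (1ℚ ℚ.- t)
        ≡⟨ ℚₚ.*-inverseˡ (1ℚ ℚ.- t) ⟩
      1ℚ
        ∎
      where open ≡-Reasoning

extreme-dominated-≐ : ∀ {n} {A B : Mat n} {t} → ExtremeΩth A → InΩth B → 0ℚ < t → t < 1ℚ →
                      (∀ i j → t * B i j ≤ A i j) → A ≐ B
extreme-dominated-≐ {A = A} {B} {t} (inA , extreme) inB 0<t t<1 tB≤A i j = begin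
  A i j                           ≡⟨ residual-decomposes A B t<1 i j ⟩
  t * B i j + (1ℚ ℚ.- t) * C i j  ≡⟨ cong (λ c → t * B i j + (1ℚ ℚ.- t) * c) (B≐C i j) ⟨
  t * B i j + (1ℚ ℚ.- t) * B i j  ≡⟨ solve 2 (λ t b → t :* b :+ (con 1ℚ :+ :- t) :* b := b) refl t (B i j) ⟩
  B i j                           ∎
  where
  open ≡-Reasoning
  C = residual A B t<1
  B≐C : B ≐ C
  B≐C = extreme B C t inB (residual-inΩth A B t<1 inA inB tB≤A) 0<t t<1 (residual-decomposes A B t<1)

positiveLowerBound : ∀ {n} (b : ℚ) (g : Fin n → ℚ) → 0ℚ < b → (∀ i → 0ℚ < g i) →
                     ∃[ ε ] 0ℚ < ε × ε ≤ b × (∀ i → ε ≤ g i)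
positiveLowerBound b g 0<b 0<g =
  min b xs , argmin-all id {P = 0ℚ <_} 0<b (tabulate⁺ 0<g) , min≤⊤ b xs , tabulate⁻ (min≤xs b xs)
  where xs = List.tabulate g

lemma3p5 : (n : ℕ) (A : Mat n) → ExtremeΩth A →
    Σ (Permutation′ n) λ σ →
      A ≐ ((½ * ½) • (((permMat σ ⊕ (permMat σ ᵗ)) ⊕ (permMat σ ʰ)) ⊕ (permMat σ ᵖ)))
      × A ≐ (½ • ((½ • (permMat σ ⊕ (permMat σ ᵖ))) ⊕ ((½ • (permMat σ ⊕ (permMat σ ᵖ))) ᵗ)))
      × Centrosymmetric (½ • (permMat σ ⊕ (permMat σ ᵖ)))
lemma3p5 n A ext@((ds , symA , hankelA) , _) =
  σ , (λ i j → trans (A≐Q i j) (symmetrise-≐-quarterSum P i j)) , A≐Q , centroAverage-centrosymmetric P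
  where
  diagonal = doublyStochastic⇒positiveDiagonal ds
  σ = proj₁ diagonal
  P = permMat σ

  A≐Q : A ≐ symmetrise P
  A≐Q =
    let ε , 0<ε , ε≤½ , ε≤diagonal =
          positiveLowerBound ½ (λ i → A i (σ ⟨$⟩ʳ i)) (ℚₚ.positive⁻¹ ½) (proj₂ diagonal)
        ε<1 = ℚₚ.≤-<-trans ε≤½ (toWitness {a? = ½ <? 1ℚ} _)
        εP≤A = permMat-dominated σ (proj₁ ds) ε≤diagonal
    in extreme-dominated-≐ ext (symmetrise-inΩth (permMat-doublyStochastic σ)) 0<ε ε<1
         (symmetrise-dominated {B = P} {t = ε} symA hankelA εP≤A)
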